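{- For all non-negative integers $n,m,p$, \[ \sum_{k=0}^{m}B_{n,p}(k+1)=\frac{B_{n+1}(m+1)-B_{n+1}}{n+1}+\frac{p+1}{p+2}\left(B_{n,p+1}(m+1)-B_{n,p+1}\right). \] In particular, for $p=0$, \[ \sum_{k=0}^{m}\left[B_{n}(k+1)+n\,k^{n}\right]=(m+1)\,B_{n}(m+1). \]
   Context: The Bernoulli polynomials are defined by $\sum_{n\ge0}B_n(x)\frac{t^n}{n!}=\frac{te^{xt}}{e^t-1}$ and $B_n=B_n(0)$. For each integer $p\geq 0$, the $p$-Bernoulli numbers $B_{n,p}$ are defined by $B_{0,p}=1$ and $B_{n+1,p}=pB_{n,p}-\frac{(p+1)^{2}}{p+2}B_{n,p+1}$ ($n,p\ge 0$), and the $p$-Bernoulli polynomials by $B_{n,p}(x)=\sum_{k=0}^{n}\binom{n}{k}x^{n-k}B_{k,p}$; for $p=0$ these are $B_{n,0}(x)=B_n(x)$. The convention $0^0=1$ is used. -}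

module Defs where

open import Data.Nat as ℕ using (ℕ; zero; suc)
open import Data.Nat.Combinatorics using (_C_)
open import Data.Integer using (+_)
open import Data.Fin using (Fin; toℕ)
open import Data.Vec using (Vec; []; _∷_; _∷ʳ_; last; lookup)
open import Data.Rational using (ℚ; _+_; _*_; _-_; -_; _/_; 0ℚ; 1ℚ)

⟦_⟧ : ℕ → ℚ
⟦ n ⟧ = (+ n) / 1

-- power on ℚ with the convention 0^0 = 1
_^q_ : ℚ → ℕ → ℚ
x ^q zero = 1ℚ
x ^q suc n = x * (x ^q n)

sumTo : ℕ → (ℕ → ℚ) → ℚ
sumTo zero f = f 0
sumTo (suc m) f = sumTo m f + f (suc m)

-- Bernoulli numbers from t/(e^t - 1) (so B_1 = -1/2).
-- Comparing coefficients of t^(N+1) in (e^t - 1) * sum B_k t^k/k! = t gives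
--   B_0 = 1,   sum_{k=0}^{N} C(N+1,k) B_k = 0  (N ≥ 1),
-- i.e. B_N = -(1/(N+1)) * sum_{k=0}^{N-1} C(N+1,k) B_k.
-- bernVec n = [B_0, ..., B_n].
bernVec : (n : ℕ) → Vec ℚ (suc n)
bernVec zero = 1ℚ ∷ []
bernVec (suc n) = prev ∷ʳ new
  where
  prev : Vec ℚ (suc n)
  prev = bernVec n
  s : (m : ℕ) → Vec ℚ m → ℚ
  s _ [] = 0ℚ
  s (suc m) (b ∷ bs) = ⟦ (suc (suc n)) C (n ∸' m) ⟧ * b + s m bs
    where
    _∸'_ : ℕ → ℕ → ℕ
    a ∸' c = a ℕ.∸ c
  new : ℚ
  new = - ((+ 1 / suc (suc n)) * s (suc n) prev)

B : ℕ → ℚ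
B n = last (bernVec n)

Bpoly : ℕ → ℚ → ℚ
Bpoly n x = sumTo n (λ k → ⟦ n C k ⟧ * B k * (x ^q (n ℕ.∸ k)))

Bp : ℕ → ℕ → ℚ
Bp zero p = 1ℚ
Bp (suc n) p = ⟦ p ⟧ * Bp n p - ((+ ((suc p) ℕ.* (suc p))) / suc (suc p)) * Bp n (suc p)

Bppoly : ℕ → ℕ → ℚ → ℚ
Bppoly n p x = sumTo n (λ k → ⟦ n C k ⟧ * (x ^q (n ℕ.∸ k)) * Bp k p)

-- Both sums telescope. Writing the polynomials as umbral powers (x + a)ⁿ = Σₖ C(n,k) xⁿ⁻ᵏ aₖ, the
-- translation x ↦ x + 1 together with Σ_{k≤N} C(N+1,k) Bₖ = 0 gives B_{n+1}(x+1) − B_{n+1}(x) = (n+1) xⁿ,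
-- whose sum over x = 0, …, m is Faulhaber's formula. The recurrence of the p-Bernoulli numbers makes
-- B_{n+1,p}(x) = (x + p) B_{n,p}(x) − (p+1)²/(p+2) B_{n,p+1}(x), and induction on n, for all p at once,
-- yields B_{n,p}(x+1) = xⁿ + (p+1)/(p+2) (B_{n,p+1}(x+1) − B_{n,p+1}(x)); summing gives the first
-- identity. The second telescopes (k+1) B_n(k+1) − k B_n(k) = B_n(k+1) + n kⁿ.
{-# OPTIONS --safe #-}
module Submission where

open import Data.Nat as ℕ using (ℕ; zero; suc; _∸_; _≤_; z≤n)
import Data.Nat.Properties as ℕ
open import Data.Nat.Combinatorics
  using (_C_; nCk+nC[k+1]≡[n+1]C[k+1]; nCn≡1; nC1≡n; nCk≡nC[n∸k]; k>n⇒nCk≡0)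
open import Data.Integer as ℤ using (+_)
import Data.Integer.Properties as ℤ
import Data.Integer.Tactic.RingSolver as ℤ-Solver
import Data.Nat.Tactic.RingSolver as ℕ-Solver
open import Data.Rational using (ℚ; _+_; _*_; _-_; -_; _/_; 0ℚ; 1ℚ; toℚᵘ)
open import Data.Rational.Properties
  using (_≟_; +-*-commutativeRing; toℚᵘ-injective; toℚᵘ-fromℚᵘ; toℚᵘ-homo-+; toℚᵘ-homo-*;
         *-distribˡ-+; +-identityʳ; +-comm; +-assoc; *-identityˡ; *-identityʳ; *-assoc)
open import Data.Rational.Unnormalised as ℚᵘ using (mkℚᵘ; *≡*)
import Data.Rational.Unnormalised.Properties as ℚᵘ
open import Data.Vec using (Vec; []; _∷_; _∷ʳ_)
open import Data.Vec.Properties using (last-∷ʳ)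
open import Data.Product using (_×_; _,_)
open import Function using (_∘_)
open import Relation.Nullary.Decidable using (dec⇒maybe)
open import Relation.Binary.PropositionalEquality
open import Tactic.RingSolver using (solve-∀)
import Tactic.RingSolver.Core.AlmostCommutativeRing as ACR

open import Defs

-- Without the zero test solve-∀ cannot cancel rational coefficients and fails even on (x + y) * (x - y) ≡ x * x - y * y.
ℚ-ring : ACR.AlmostCommutativeRing _ _
ℚ-ring = ACR.fromCommutativeRing +-*-commutativeRing (λ x → dec⇒maybe (0ℚ ≟ x))

module _ where
  open ℚᵘ.≃-Reasoning

  private
    toℚᵘ-/ : ∀ a d → toℚᵘ (+ a / suc d) ℚᵘ.≃ mkℚᵘ (+ a) d
    toℚᵘ-/ a d = toℚᵘ-fromℚᵘ (mkℚᵘ (+ a) d)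

  ⟦+⟧ : ∀ a b → ⟦ a ℕ.+ b ⟧ ≡ ⟦ a ⟧ + ⟦ b ⟧
  ⟦+⟧ a b = toℚᵘ-injective (begin
    toℚᵘ ⟦ a ℕ.+ b ⟧                ≈⟨ toℚᵘ-/ (a ℕ.+ b) 0 ⟩
    mkℚᵘ (+ (a ℕ.+ b)) 0            ≈⟨ *≡* (trans (cong (ℤ._* + 1) (ℤ.pos-+ a b)) (identity (+ a) (+ b))) ⟩
    mkℚᵘ (+ a) 0 ℚᵘ.+ mkℚᵘ (+ b) 0  ≈⟨ ℚᵘ.+-cong (toℚᵘ-/ a 0) (toℚᵘ-/ b 0) ⟨
    toℚᵘ ⟦ a ⟧ ℚᵘ.+ toℚᵘ ⟦ b ⟧      ≈⟨ toℚᵘ-homo-+ ⟦ a ⟧ ⟦ b ⟧ ⟨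
    toℚᵘ (⟦ a ⟧ + ⟦ b ⟧)            ∎)
    where
    identity : ∀ x y → (x ℤ.+ y) ℤ.* + 1 ≡ (x ℤ.* + 1 ℤ.+ y ℤ.* + 1) ℤ.* + 1
    identity = ℤ-Solver.solve-∀

  ⟦*⟧ : ∀ a b → ⟦ a ℕ.* b ⟧ ≡ ⟦ a ⟧ * ⟦ b ⟧
  ⟦*⟧ a b = toℚᵘ-injective (begin
    toℚᵘ ⟦ a ℕ.* b ⟧                ≈⟨ toℚᵘ-/ (a ℕ.* b) 0 ⟩
    mkℚᵘ (+ (a ℕ.* b)) 0            ≈⟨ *≡* (cong (ℤ._* + 1) (ℤ.pos-* a b)) ⟩
    mkℚᵘ (+ a) 0 ℚᵘ.* mkℚᵘ (+ b) 0  ≈⟨ ℚᵘ.*-cong (toℚᵘ-/ a 0) (toℚᵘ-/ b 0) ⟨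
    toℚᵘ ⟦ a ⟧ ℚᵘ.* toℚᵘ ⟦ b ⟧      ≈⟨ toℚᵘ-homo-* ⟦ a ⟧ ⟦ b ⟧ ⟨
    toℚᵘ (⟦ a ⟧ * ⟦ b ⟧)            ∎)

  /-as-* : ∀ a d → + a / suc d ≡ ⟦ a ⟧ * (+ 1 / suc d)
  /-as-* a d = toℚᵘ-injective (begin
    toℚᵘ (+ a / suc d)                   ≈⟨ toℚᵘ-/ a d ⟩
    mkℚᵘ (+ a) d                         ≈⟨ *≡* (identity (+ a) (+ suc d)) ⟩
    mkℚᵘ (+ a) 0 ℚᵘ.* mkℚᵘ (+ 1) d       ≈⟨ ℚᵘ.*-cong (toℚᵘ-/ a 0) (toℚᵘ-/ 1 d) ⟨
    toℚᵘ ⟦ a ⟧ ℚᵘ.* toℚᵘ (+ 1 / suc d)   ≈⟨ toℚᵘ-homo-* ⟦ a ⟧ (+ 1 / suc d) ⟨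
    toℚᵘ (⟦ a ⟧ * (+ 1 / suc d))         ∎)
    where
    identity : ∀ x y → x ℤ.* (+ 1 ℤ.* y) ≡ (x ℤ.* + 1) ℤ.* y
    identity = ℤ-Solver.solve-∀

  /-inverseˡ : ∀ d → (+ 1 / suc d) * ⟦ suc d ⟧ ≡ 1ℚ
  /-inverseˡ d = toℚᵘ-injective (begin
    toℚᵘ ((+ 1 / suc d) * ⟦ suc d ⟧)      ≈⟨ toℚᵘ-homo-* (+ 1 / suc d) ⟦ suc d ⟧ ⟩
    toℚᵘ (+ 1 / suc d) ℚᵘ.* toℚᵘ ⟦ suc d ⟧ ≈⟨ ℚᵘ.*-cong (toℚᵘ-/ 1 d) (toℚᵘ-/ (suc d) 0) ⟩
    mkℚᵘ (+ 1) d ℚᵘ.* mkℚᵘ (+ suc d) 0     ≈⟨ *≡* (cong (+_ ∘ suc) (identity d)) ⟩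
    toℚᵘ 1ℚ                                ∎)
    where
    identity : ∀ d → (d ℕ.+ 0 ℕ.* suc d) ℕ.* 1 ≡ d ℕ.* 1 ℕ.+ 0 ℕ.* suc (d ℕ.* 1)
    identity = ℕ-Solver.solve-∀

open ≡-Reasoning

⟦suc⟧ : ∀ n → ⟦ suc n ⟧ ≡ ⟦ n ⟧ + 1ℚ
⟦suc⟧ n = trans (⟦+⟧ 1 n) (+-comm 1ℚ ⟦ n ⟧)

sumTo-cong : ∀ m {f g : ℕ → ℚ} → (∀ k → k ≤ m → f k ≡ g k) → sumTo m f ≡ sumTo m g
sumTo-cong zero    f≗g = f≗g 0 z≤n
sumTo-cong (suc m) f≗g =
  cong₂ _+_ (sumTo-cong m (λ k k≤m → f≗g k (ℕ.m≤n⇒m≤1+n k≤m))) (f≗g (suc m) ℕ.≤-refl)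

sumTo-suc : ∀ m (f : ℕ → ℚ) → sumTo (suc m) f ≡ f 0 + sumTo m (f ∘ suc)
sumTo-suc zero    f = refl
sumTo-suc (suc m) f = begin
  sumTo (suc m) f + f (suc (suc m))               ≡⟨ cong (_+ f (suc (suc m))) (sumTo-suc m f) ⟩
  f 0 + sumTo m (f ∘ suc) + f (suc (suc m))       ≡⟨ +-assoc (f 0) (sumTo m (f ∘ suc)) (f (suc (suc m))) ⟩
  f 0 + (sumTo m (f ∘ suc) + f (suc (suc m)))     ∎

sumTo-+ : ∀ m (f g : ℕ → ℚ) → sumTo m (λ k → f k + g k) ≡ sumTo m f + sumTo m g
sumTo-+ zero    f g = refl
sumTo-+ (suc m) f g = trans (cong (_+ (f (suc m) + g (suc m))) (sumTo-+ m f g))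
                            (interchange (sumTo m f) (sumTo m g) (f (suc m)) (g (suc m)))
  where
  interchange : ∀ a b c d → a + b + (c + d) ≡ a + c + (b + d)
  interchange = solve-∀ ℚ-ring

sumTo-* : ∀ m c (f : ℕ → ℚ) → sumTo m (λ k → c * f k) ≡ c * sumTo m f
sumTo-* zero    c f = refl
sumTo-* (suc m) c f = trans (cong (_+ c * f (suc m)) (sumTo-* m c f))
                            (sym (*-distribˡ-+ c (sumTo m f) (f (suc m))))

sumTo-telescope : ∀ m (f : ℕ → ℚ) → sumTo m (λ k → f (suc k) - f k) ≡ f (suc m) - f 0
sumTo-telescope zero    f = refl
sumTo-telescope (suc m) f = trans (cong (_+ (f (suc (suc m)) - f (suc m))) (sumTo-telescope m f))
                                  (collapse (f 0) (f (suc m)) (f (suc (suc m))))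
  where
  collapse : ∀ a b c → b - a + (c - b) ≡ c - a
  collapse = solve-∀ ℚ-ring

⟦C⟧-pascal : ∀ n k → ⟦ suc n C suc k ⟧ ≡ ⟦ n C k ⟧ + ⟦ n C suc k ⟧
⟦C⟧-pascal n k = trans (cong ⟦_⟧ (sym (nCk+nC[k+1]≡[n+1]C[k+1] n k))) (⟦+⟧ (n C k) (n C suc k))

binomialSum : ℕ → ℚ → (ℕ → ℚ) → ℚ
binomialSum n y a = sumTo n (λ k → ⟦ n C k ⟧ * (y ^q (n ∸ k)) * a k)

-- appell n y a is the umbral power (y + a)ⁿ; its recursion mirrors (y + a)ⁿ⁺¹ = y (y + a)ⁿ + a (y + a)ⁿ.
appell : ℕ → ℚ → (ℕ → ℚ) → ℚ
appell zero    y a = a 0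
appell (suc n) y a = y * appell n y a + appell n y (a ∘ suc)

binomialSum-suc : ∀ n y a → binomialSum (suc n) y a ≡ y * binomialSum n y a + binomialSum n y (a ∘ suc)
binomialSum-suc n y a = begin
  binomialSum (suc n) y a
    ≡⟨ sumTo-suc n _ ⟩
  f 0 + sumTo n (λ k → ⟦ suc n C suc k ⟧ * (y ^q (n ∸ k)) * a (suc k))
    ≡⟨ cong (λ t → f 0 + t) (trans (sumTo-cong n (λ k _ → pascal k)) (sumTo-+ n _ _)) ⟩
  f 0 + (binomialSum n y (a ∘ suc) + sumTo n (f ∘ suc))
    ≡⟨ swap (f 0) (binomialSum n y (a ∘ suc)) (sumTo n (f ∘ suc)) ⟩
  f 0 + sumTo n (f ∘ suc) + binomialSum n y (a ∘ suc)
    ≡⟨ cong (_+ binomialSum n y (a ∘ suc)) lower-terms ⟩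
  y * binomialSum n y a + binomialSum n y (a ∘ suc) ∎
  where
  f : ℕ → ℚ
  f k = ⟦ n C k ⟧ * (y ^q (suc n ∸ k)) * a k

  pascal : ∀ k → ⟦ suc n C suc k ⟧ * (y ^q (n ∸ k)) * a (suc k)
               ≡ ⟦ n C k ⟧ * (y ^q (n ∸ k)) * a (suc k) + f (suc k)
  pascal k = trans (cong (λ c → c * (y ^q (n ∸ k)) * a (suc k)) (⟦C⟧-pascal n k))
                   (distrib ⟦ n C k ⟧ ⟦ n C suc k ⟧ (y ^q (n ∸ k)) (a (suc k)))
    where
    distrib : ∀ u v Y b → (u + v) * Y * b ≡ u * Y * b + v * Y * b
    distrib = solve-∀ ℚ-ring

  swap : ∀ a b c → a + (b + c) ≡ a + c + b
  swap = solve-∀ ℚ-ring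

  lower-term : ∀ k → k ≤ n → f k ≡ y * (⟦ n C k ⟧ * (y ^q (n ∸ k)) * a k)
  lower-term k k≤n = trans (cong (λ e → ⟦ n C k ⟧ * (y ^q e) * a k) (ℕ.+-∸-assoc 1 k≤n))
                           (pull y ⟦ n C k ⟧ (y ^q (n ∸ k)) (a k))
    where
    pull : ∀ y c Y b → c * (y * Y) * b ≡ y * (c * Y * b)
    pull = solve-∀ ℚ-ring

  top-term : f (suc n) ≡ 0ℚ
  top-term = trans (cong (λ c → ⟦ c ⟧ * (y ^q (n ∸ n)) * a (suc n)) (k>n⇒nCk≡0 (ℕ.n<1+n n)))
                   (annihilate (y ^q (n ∸ n)) (a (suc n)))
    where
    annihilate : ∀ Y b → 0ℚ * Y * b ≡ 0ℚ
    annihilate = solve-∀ ℚ-ring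

  lower-terms : f 0 + sumTo n (f ∘ suc) ≡ y * binomialSum n y a
  lower-terms = begin
    f 0 + sumTo n (f ∘ suc)  ≡⟨ sumTo-suc n f ⟨
    sumTo n f + f (suc n)    ≡⟨ trans (cong (λ t → sumTo n f + t) top-term) (+-identityʳ (sumTo n f)) ⟩
    sumTo n f                ≡⟨ trans (sumTo-cong n lower-term) (sumTo-* n y _) ⟩
    y * binomialSum n y a    ∎

binomialSum≡appell : ∀ n y a → binomialSum n y a ≡ appell n y a
binomialSum≡appell zero    y a = *-identityˡ (a 0)
binomialSum≡appell (suc n) y a = begin
  binomialSum (suc n) y a                             ≡⟨ binomialSum-suc n y a ⟩
  y * binomialSum n y a + binomialSum n y (a ∘ suc)   ≡⟨ cong₂ (λ u v → y * u + v) (binomialSum≡appell n y a)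
                                                                                (binomialSum≡appell n y (a ∘ suc)) ⟩
  y * appell n y a + appell n y (a ∘ suc)             ∎

appell-cong : ∀ n y {a b : ℕ → ℚ} → (∀ k → a k ≡ b k) → appell n y a ≡ appell n y b
appell-cong zero    y a≗b = a≗b 0
appell-cong (suc n) y a≗b = cong₂ (λ u v → y * u + v) (appell-cong n y a≗b) (appell-cong n y (a≗b ∘ suc))

appell-+ : ∀ n y (a b : ℕ → ℚ) → appell n y (λ k → a k + b k) ≡ appell n y a + appell n y b
appell-+ zero    y a b = refl
appell-+ (suc n) y a b =
  trans (cong₂ (λ u v → y * u + v) (appell-+ n y a b) (appell-+ n y (a ∘ suc) (b ∘ suc)))
        (regroup y (appell n y a) (appell n y b) (appell n y (a ∘ suc)) (appell n y (b ∘ suc)))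
  where
  regroup : ∀ y u₁ u₂ v₁ v₂ → y * (u₁ + u₂) + (v₁ + v₂) ≡ y * u₁ + v₁ + (y * u₂ + v₂)
  regroup = solve-∀ ℚ-ring

appell-* : ∀ n y c (a : ℕ → ℚ) → appell n y (λ k → c * a k) ≡ c * appell n y a
appell-* zero    y c a = refl
appell-* (suc n) y c a =
  trans (cong₂ (λ u v → y * u + v) (appell-* n y c a) (appell-* n y c (a ∘ suc)))
        (factor y c (appell n y a) (appell n y (a ∘ suc)))
  where
  factor : ∀ y c u v → y * (c * u) + c * v ≡ c * (y * u + v)
  factor = solve-∀ ℚ-ring

appell-zero : ∀ n y → appell n y (λ _ → 0ℚ) ≡ 0ℚ
appell-zero zero    y = refl
appell-zero (suc n) y = trans (cong₂ (λ u v → y * u + v) (appell-zero n y) (appell-zero n y)) (vanish y)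
  where
  vanish : ∀ y → y * 0ℚ + 0ℚ ≡ 0ℚ
  vanish = solve-∀ ℚ-ring

appell-at-0 : ∀ n (a : ℕ → ℚ) → appell n 0ℚ a ≡ a n
appell-at-0 zero    a = refl
appell-at-0 (suc n) a = trans (cong (λ v → 0ℚ * appell n 0ℚ a + v) (appell-at-0 n (a ∘ suc)))
                              (vanish (appell n 0ℚ a) (a (suc n)))
  where
  vanish : ∀ u v → 0ℚ * u + v ≡ v
  vanish = solve-∀ ℚ-ring

appell-translate : ∀ n x y (a : ℕ → ℚ) → appell n (x + y) a ≡ appell n x (λ j → appell j y a)
appell-translate zero    x y a = refl
appell-translate (suc n) x y a = begin
  (x + y) * appell n (x + y) a + appell n (x + y) (a ∘ suc)
    ≡⟨ cong₂ (λ u v → (x + y) * u + v) (appell-translate n x y a) (appell-translate n x y (a ∘ suc)) ⟩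
  (x + y) * appell n x b + appell n x b′
    ≡⟨ distrib x y (appell n x b) (appell n x b′) ⟩
  x * appell n x b + (y * appell n x b + appell n x b′)
    ≡⟨ cong (λ t → x * appell n x b + t) (sym (trans (appell-+ n x _ b′) (cong (_+ appell n x b′) (appell-* n x y b)))) ⟩
  x * appell n x b + appell n x (λ j → y * b j + b′ j) ∎
  where
  b b′ : ℕ → ℚ
  b  j = appell j y a
  b′ j = appell j y (a ∘ suc)

  distrib : ∀ x y u v → (x + y) * u + v ≡ x * u + (y * u + v)
  distrib = solve-∀ ℚ-ring

δ₀ δ₁ : ℕ → ℚ
δ₀ zero    = 1ℚ
δ₀ (suc _) = 0ℚ
δ₁ zero    = 0ℚ
δ₁ (suc k) = δ₀ k

appell-δ₀ : ∀ n y → appell n y δ₀ ≡ y ^q n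
appell-δ₀ zero    y = refl
appell-δ₀ (suc n) y = trans (cong₂ (λ u v → y * u + v) (appell-δ₀ n y) (appell-zero n y)) (+-identityʳ _)

appell-δ₁ : ∀ n y → appell (suc n) y δ₁ ≡ ⟦ suc n ⟧ * (y ^q n)
appell-δ₁ zero    y = simplify y
  where
  simplify : ∀ y → y * 0ℚ + 1ℚ ≡ 1ℚ * 1ℚ
  simplify = solve-∀ ℚ-ring
appell-δ₁ (suc n) y = begin
  y * appell (suc n) y δ₁ + appell (suc n) y δ₀ ≡⟨ cong₂ (λ u v → y * u + v) (appell-δ₁ n y) (appell-δ₀ (suc n) y) ⟩
  y * (⟦ suc n ⟧ * (y ^q n)) + y * (y ^q n)     ≡⟨ collect y ⟦ suc n ⟧ (y ^q n) ⟩
  (⟦ suc n ⟧ + 1ℚ) * (y * (y ^q n))             ≡⟨ cong (_* (y * (y ^q n))) (⟦suc⟧ (suc n)) ⟨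
  ⟦ suc (suc n) ⟧ * (y * (y ^q n))              ∎
  where
  collect : ∀ y K Y → y * (K * Y) + y * Y ≡ (K + 1ℚ) * (y * Y)
  collect = solve-∀ ℚ-ring

-- The inner sum s of bernVec is local to its definition. bernoulliStep recovers it by abstracting
-- its arguments with `with`; B and 1/(n+2) are kept opaque so that the abstraction does not unfold them.
record BernoulliStep (n : ℕ) : Set where
  field
    σ     : (m : ℕ) → Vec ℚ m → ℚ
    σ-[]  : σ 0 [] ≡ 0ℚ
    σ-∷   : ∀ m b bs → σ (suc m) (b ∷ bs) ≡ ⟦ suc (suc n) C (n ∸ m) ⟧ * b + σ m bs
    B-suc : B (suc n) ≡ - ((+ 1 / suc (suc n)) * σ (suc n) (bernVec n))

private
  opaque
    B′ : ℕ → ℚ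
    B′ = B

    inverse : ℕ → ℚ
    inverse n = + 1 / suc n

  opaque
    unfolding B′ inverse

    fold : ∀ n x → B (suc n) ≡ - ((+ 1 / suc (suc n)) * x) → B′ (suc n) ≡ - (inverse (suc n) * x)
    fold n x eq = eq

    unfold : ∀ n x → B′ (suc n) ≡ - (inverse (suc n) * x) → B (suc n) ≡ - ((+ 1 / suc (suc n)) * x)
    unfold n x eq = eq

bernoulliStep : ∀ n → BernoulliStep n
bernoulliStep n = record { σ = σ ; σ-[] = refl ; σ-∷ = λ _ _ _ → refl ; B-suc = unfold n _ B′-suc }
  where
  σ : (m : ℕ) → Vec ℚ m → ℚ
  σ = _

  B′-suc : B′ (suc n) ≡ - (inverse (suc n) * σ (suc n) (bernVec n))
  B′-suc with suc n | bernVec n | fold n _ (last-∷ʳ _ (bernVec n))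
  ... | _ | _ | eq = eq

tabulateℕ : (m : ℕ) → (ℕ → ℚ) → Vec ℚ m
tabulateℕ zero    g = []
tabulateℕ (suc m) g = g 0 ∷ tabulateℕ m (g ∘ suc)

tabulateℕ-suc : ∀ m (g : ℕ → ℚ) → tabulateℕ (suc m) g ≡ tabulateℕ m g ∷ʳ g m
tabulateℕ-suc zero    g = refl
tabulateℕ-suc (suc m) g = cong (g 0 ∷_) (tabulateℕ-suc m (g ∘ suc))

bernVec≡tabulateℕ : ∀ n → bernVec n ≡ tabulateℕ (suc n) B
bernVec≡tabulateℕ zero    = refl
bernVec≡tabulateℕ (suc n) = begin
  bernVec (suc n)                   ≡⟨ cong (bernVec n ∷ʳ_) (sym (last-∷ʳ _ (bernVec n))) ⟩
  bernVec n ∷ʳ B (suc n)            ≡⟨ cong (_∷ʳ B (suc n)) (bernVec≡tabulateℕ n) ⟩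
  tabulateℕ (suc n) B ∷ʳ B (suc n)  ≡⟨ tabulateℕ-suc (suc n) B ⟨
  tabulateℕ (suc (suc n)) B         ∎

module _ {n} (step : BernoulliStep n) where
  open BernoulliStep step

  private
    coefficient : ℕ → ℚ → ℚ
    coefficient k b = ⟦ suc (suc n) C k ⟧ * b

    ∸-offset : ∀ o m → o ℕ.+ m ≡ n → n ∸ m ≡ o ℕ.+ 0
    ∸-offset o m o+m≡n = trans (cong (_∸ m) (sym o+m≡n)) (trans (ℕ.m+n∸n≡m o m) (sym (ℕ.+-identityʳ o)))

  σ-tabulateℕ : ∀ o m (g : ℕ → ℚ) → o ℕ.+ m ≡ n →
                σ (suc m) (tabulateℕ (suc m) g) ≡ sumTo m (λ i → coefficient (o ℕ.+ i) (g i))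
  σ-tabulateℕ o zero g o+0≡n = begin
    σ 1 (g 0 ∷ [])                       ≡⟨ σ-∷ 0 (g 0) [] ⟩
    coefficient (n ∸ 0) (g 0) + σ 0 []   ≡⟨ cong₂ _+_ (cong (λ k → coefficient k (g 0)) (∸-offset o 0 o+0≡n)) σ-[] ⟩
    coefficient (o ℕ.+ 0) (g 0) + 0ℚ     ≡⟨ +-identityʳ _ ⟩
    coefficient (o ℕ.+ 0) (g 0)          ∎
  σ-tabulateℕ o (suc m) g o+m≡n = begin
    σ (suc (suc m)) (tabulateℕ (suc (suc m)) g)
      ≡⟨ σ-∷ (suc m) (g 0) (tabulateℕ (suc m) (g ∘ suc)) ⟩
    coefficient (n ∸ suc m) (g 0) + σ (suc m) (tabulateℕ (suc m) (g ∘ suc))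
      ≡⟨ cong₂ _+_ (cong (λ k → coefficient k (g 0)) (∸-offset o (suc m) o+m≡n))
                   (σ-tabulateℕ (suc o) m (g ∘ suc) (trans (sym (ℕ.+-suc o m)) o+m≡n)) ⟩
    coefficient (o ℕ.+ 0) (g 0) + sumTo m (λ i → coefficient (suc o ℕ.+ i) (g (suc i)))
      ≡⟨ cong (λ t → coefficient (o ℕ.+ 0) (g 0) + t)
              (sumTo-cong m (λ i _ → cong (λ k → coefficient k (g (suc i))) (sym (ℕ.+-suc o i)))) ⟩
    coefficient (o ℕ.+ 0) (g 0) + sumTo m (λ i → coefficient (o ℕ.+ suc i) (g (suc i)))
      ≡⟨ sumTo-suc m (λ i → coefficient (o ℕ.+ i) (g i)) ⟨
    sumTo (suc m) (λ i → coefficient (o ℕ.+ i) (g i)) ∎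

[n+1]Cn≡n+1 : ∀ n → suc n C n ≡ suc n
[n+1]Cn≡n+1 n = trans (nCk≡nC[n∸k] (ℕ.n≤1+n n)) (trans (cong (suc n C_) (ℕ.m+n∸n≡m 1 n)) (nC1≡n (suc n)))

Bernoulli-recurrence : ∀ n → sumTo (suc n) (λ k → ⟦ suc (suc n) C k ⟧ * B k) ≡ 0ℚ
Bernoulli-recurrence n = begin
  S + ⟦ suc (suc n) C suc n ⟧ * B (suc n)   ≡⟨ cong₂ (λ c b → S + ⟦ c ⟧ * b) ([n+1]Cn≡n+1 (suc n)) B-suc′ ⟩
  S + ⟦ suc (suc n) ⟧ * - (I * S)           ≡⟨ regroup S I ⟦ suc (suc n) ⟧ ⟩
  S - I * ⟦ suc (suc n) ⟧ * S               ≡⟨ cong (λ c → S - c * S) (/-inverseˡ (suc n)) ⟩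
  S - 1ℚ * S                                ≡⟨ cancel S ⟩
  0ℚ                                        ∎
  where
  open BernoulliStep (bernoulliStep n)
  S = sumTo n (λ k → ⟦ suc (suc n) C k ⟧ * B k)
  I = + 1 / suc (suc n)

  B-suc′ : B (suc n) ≡ - (I * S)
  B-suc′ = begin
    B (suc n)                                  ≡⟨ B-suc ⟩
    - (I * σ (suc n) (bernVec n))              ≡⟨ cong (λ v → - (I * σ (suc n) v)) (bernVec≡tabulateℕ n) ⟩
    - (I * σ (suc n) (tabulateℕ (suc n) B))    ≡⟨ cong (λ t → - (I * t)) (σ-tabulateℕ (bernoulliStep n) 0 n B refl) ⟩
    - (I * S)                                  ∎

  regroup : ∀ S I K → S + K * - (I * S) ≡ S - I * K * S
  regroup = solve-∀ ℚ-ring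
  cancel : ∀ S → S - 1ℚ * S ≡ 0ℚ
  cancel = solve-∀ ℚ-ring

1^q≡1 : ∀ m → 1ℚ ^q m ≡ 1ℚ
1^q≡1 zero    = refl
1^q≡1 (suc m) = trans (cong (1ℚ *_) (1^q≡1 m)) (*-identityˡ 1ℚ)

appell-B-at-1 : ∀ n → appell n 1ℚ B ≡ B n + δ₁ n
appell-B-at-1 zero          = sym (+-identityʳ (B 0))
appell-B-at-1 (suc zero)    = simplify (B 1)
  where
  simplify : ∀ b → 1ℚ * 1ℚ + b ≡ b + 1ℚ
  simplify = solve-∀ ℚ-ring
appell-B-at-1 (suc (suc n)) = begin
  appell N 1ℚ B                                    ≡⟨ binomialSum≡appell N 1ℚ B ⟨
  binomialSum N 1ℚ B                               ≡⟨ sumTo-cong N (λ k _ → drop-power k) ⟩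
  sumTo (suc n) g + ⟦ N C N ⟧ * B N                ≡⟨ cong₂ (λ s c → s + ⟦ c ⟧ * B N) (Bernoulli-recurrence n) (nCn≡1 N) ⟩
  0ℚ + 1ℚ * B N                                    ≡⟨ simplify (B N) ⟩
  B N + 0ℚ                                         ∎
  where
  N = suc (suc n)
  g : ℕ → ℚ
  g k = ⟦ N C k ⟧ * B k

  drop-power : ∀ k → ⟦ N C k ⟧ * (1ℚ ^q (N ∸ k)) * B k ≡ g k
  drop-power k = trans (cong (λ u → ⟦ N C k ⟧ * u * B k) (1^q≡1 (N ∸ k))) (unit ⟦ N C k ⟧ (B k))
    where
    unit : ∀ c b → c * 1ℚ * b ≡ c * b
    unit = solve-∀ ℚ-ring

  simplify : ∀ b → 0ℚ + 1ℚ * b ≡ b + 0ℚ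
  simplify = solve-∀ ℚ-ring

Bpoly≡appell : ∀ n y → Bpoly n y ≡ appell n y B
Bpoly≡appell n y = trans (sumTo-cong n (λ k _ → swap ⟦ n C k ⟧ (B k) (y ^q (n ∸ k)))) (binomialSum≡appell n y B)
  where
  swap : ∀ c b Y → c * b * Y ≡ c * Y * b
  swap = solve-∀ ℚ-ring

Bpoly-at-0 : ∀ n → Bpoly n 0ℚ ≡ B n
Bpoly-at-0 n = trans (Bpoly≡appell n 0ℚ) (appell-at-0 n B)

Bpoly-difference : ∀ n x → Bpoly (suc n) (x + 1ℚ) ≡ Bpoly (suc n) x + ⟦ suc n ⟧ * (x ^q n)
Bpoly-difference n x = begin
  Bpoly (suc n) (x + 1ℚ)                                ≡⟨ Bpoly≡appell (suc n) (x + 1ℚ) ⟩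
  appell (suc n) (x + 1ℚ) B                             ≡⟨ appell-translate (suc n) x 1ℚ B ⟩
  appell (suc n) x (λ j → appell j 1ℚ B)                ≡⟨ appell-cong (suc n) x appell-B-at-1 ⟩
  appell (suc n) x (λ j → B j + δ₁ j)                   ≡⟨ appell-+ (suc n) x B δ₁ ⟩
  appell (suc n) x B + appell (suc n) x δ₁              ≡⟨ cong₂ _+_ (sym (Bpoly≡appell (suc n) x)) (appell-δ₁ n x) ⟩
  Bpoly (suc n) x + ⟦ suc n ⟧ * (x ^q n)                ∎

Bp[_] : ℕ → ℕ → ℚ
Bp[ p ] k = Bp k p

ratio : ℕ → ℚ
ratio p = + suc p / suc (suc p)

ratio-*-suc : ∀ p → ratio p * ⟦ suc (suc p) ⟧ ≡ ⟦ suc p ⟧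
ratio-*-suc p = begin
  ratio p * ⟦ suc (suc p) ⟧            ≡⟨ cong (_* ⟦ suc (suc p) ⟧) (/-as-* (suc p) (suc p)) ⟩
  ⟦ suc p ⟧ * I * ⟦ suc (suc p) ⟧      ≡⟨ *-assoc ⟦ suc p ⟧ I ⟦ suc (suc p) ⟧ ⟩
  ⟦ suc p ⟧ * (I * ⟦ suc (suc p) ⟧)    ≡⟨ cong (⟦ suc p ⟧ *_) (/-inverseˡ (suc p)) ⟩
  ⟦ suc p ⟧ * 1ℚ                       ≡⟨ *-identityʳ ⟦ suc p ⟧ ⟩
  ⟦ suc p ⟧                            ∎
  where
  I = + 1 / suc (suc p)

Bp-coefficient : ∀ p → + (suc p ℕ.* suc p) / suc (suc p) ≡ ⟦ suc p ⟧ * ratio p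
Bp-coefficient p = begin
  + (suc p ℕ.* suc p) / suc (suc p)    ≡⟨ /-as-* (suc p ℕ.* suc p) (suc p) ⟩
  ⟦ suc p ℕ.* suc p ⟧ * I              ≡⟨ cong (_* I) (⟦*⟧ (suc p) (suc p)) ⟩
  ⟦ suc p ⟧ * ⟦ suc p ⟧ * I            ≡⟨ *-assoc ⟦ suc p ⟧ ⟦ suc p ⟧ I ⟩
  ⟦ suc p ⟧ * (⟦ suc p ⟧ * I)          ≡⟨ cong (⟦ suc p ⟧ *_) (/-as-* (suc p) (suc p)) ⟨
  ⟦ suc p ⟧ * ratio p                  ∎
  where
  I = + 1 / suc (suc p)

appell-Bp-shift : ∀ n y p →
  appell n y (Bp[ p ] ∘ suc) ≡ ⟦ p ⟧ * appell n y Bp[ p ] - ⟦ suc p ⟧ * ratio p * appell n y Bp[ suc p ]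
appell-Bp-shift n y p = begin
  appell n y (Bp[ p ] ∘ suc)
    ≡⟨ appell-cong n y (λ k → trans (cong (λ d → ⟦ p ⟧ * Bp k p - d * Bp k (suc p)) (Bp-coefficient p))
                                    (subtract ⟦ p ⟧ c (Bp k p) (Bp k (suc p)))) ⟩
  appell n y (λ k → ⟦ p ⟧ * Bp k p + - c * Bp k (suc p))
    ≡⟨ appell-+ n y _ _ ⟩
  appell n y (λ k → ⟦ p ⟧ * Bp k p) + appell n y (λ k → - c * Bp k (suc p))
    ≡⟨ cong₂ _+_ (appell-* n y ⟦ p ⟧ Bp[ p ]) (appell-* n y (- c) Bp[ suc p ]) ⟩
  ⟦ p ⟧ * appell n y Bp[ p ] + - c * appell n y Bp[ suc p ]
    ≡⟨ subtract ⟦ p ⟧ c (appell n y Bp[ p ]) (appell n y Bp[ suc p ]) ⟨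
  ⟦ p ⟧ * appell n y Bp[ p ] - c * appell n y Bp[ suc p ] ∎
  where
  c = ⟦ suc p ⟧ * ratio p

  subtract : ∀ a d u v → a * u - d * v ≡ a * u + - d * v
  subtract = solve-∀ ℚ-ring

Bppoly-suc : ∀ n p y → Bppoly (suc n) p y ≡ (y + ⟦ p ⟧) * Bppoly n p y - ⟦ suc p ⟧ * ratio p * Bppoly n (suc p) y
Bppoly-suc n p y = begin
  Bppoly (suc n) p y
    ≡⟨ binomialSum≡appell (suc n) y Bp[ p ] ⟩
  y * appell n y Bp[ p ] + appell n y (Bp[ p ] ∘ suc)
    ≡⟨ cong (λ t → y * appell n y Bp[ p ] + t) (appell-Bp-shift n y p) ⟩
  y * appell n y Bp[ p ] + (⟦ p ⟧ * appell n y Bp[ p ] - c * appell n y Bp[ suc p ])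
    ≡⟨ collect y ⟦ p ⟧ c (appell n y Bp[ p ]) (appell n y Bp[ suc p ]) ⟩
  (y + ⟦ p ⟧) * appell n y Bp[ p ] - c * appell n y Bp[ suc p ]
    ≡⟨ cong₂ (λ u v → (y + ⟦ p ⟧) * u - c * v) (binomialSum≡appell n y Bp[ p ]) (binomialSum≡appell n y Bp[ suc p ]) ⟨
  (y + ⟦ p ⟧) * Bppoly n p y - c * Bppoly n (suc p) y ∎
  where
  c = ⟦ suc p ⟧ * ratio p

  collect : ∀ y P c u v → y * u + (P * u - c * v) ≡ (y + P) * u - c * v
  collect = solve-∀ ℚ-ring

Bp-defect : ℕ → ℕ → ℚ → ℚ
Bp-defect n p x = Bppoly n p (x + 1ℚ) - ratio p * (Bppoly n (suc p) (x + 1ℚ) - Bppoly n (suc p) x)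

Bp-defect-suc : ∀ n p x →
  Bp-defect (suc n) p x ≡ (x + ⟦ suc p ⟧) * Bp-defect n p x - ratio p * ⟦ suc (suc p) ⟧ * Bp-defect n (suc p) x
Bp-defect-suc n p x =
  trans (cong₂ (λ u v → u - ratio p * v) (Bppoly-suc n p (x + 1ℚ))
                                         (cong₂ _-_ (Bppoly-suc n (suc p) (x + 1ℚ)) (Bppoly-suc n (suc p) x)))
        (regroup (⟦suc⟧ p) (⟦suc⟧ (suc p)) x (ratio p) (ratio (suc p))
                 (Bppoly n p (x + 1ℚ)) (Bppoly n (suc p) (x + 1ℚ)) (Bppoly n (suc (suc p)) (x + 1ℚ))
                 (Bppoly n (suc p) x) (Bppoly n (suc (suc p)) x))
  where
  -- P₁ and P₂ stand for ⟦ suc p ⟧ and ⟦ suc (suc p) ⟧; once they are matched to P + 1 and P + 2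
  -- this is a ring identity.
  regroup : ∀ {P P₁ P₂} → P₁ ≡ P + 1ℚ → P₂ ≡ P₁ + 1ℚ → ∀ x c₀ c₁ U₀ U₁ U₂ V₁ V₂ →
    ((x + 1ℚ) + P) * U₀ - P₁ * c₀ * U₁ - c₀ * (((x + 1ℚ) + P₁) * U₁ - P₂ * c₁ * U₂ - ((x + P₁) * V₁ - P₂ * c₁ * V₂))
      ≡ (x + P₁) * (U₀ - c₀ * (U₁ - V₁)) - c₀ * P₂ * (U₁ - c₁ * (U₂ - V₂))
  regroup {P} refl refl = identity P
    where
    identity : ∀ P x c₀ c₁ U₀ U₁ U₂ V₁ V₂ →
      ((x + 1ℚ) + P) * U₀ - (P + 1ℚ) * c₀ * U₁
        - c₀ * (((x + 1ℚ) + (P + 1ℚ)) * U₁ - ((P + 1ℚ) + 1ℚ) * c₁ * U₂ - ((x + (P + 1ℚ)) * V₁ - ((P + 1ℚ) + 1ℚ) * c₁ * V₂))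
      ≡ (x + (P + 1ℚ)) * (U₀ - c₀ * (U₁ - V₁)) - c₀ * ((P + 1ℚ) + 1ℚ) * (U₁ - c₁ * (U₂ - V₂))
    identity = solve-∀ ℚ-ring

Bp-defect≡^ : ∀ n p x → Bp-defect n p x ≡ x ^q n
Bp-defect≡^ zero    p x = vanish (ratio p)
  where
  vanish : ∀ c → 1ℚ - c * (1ℚ - 1ℚ) ≡ 1ℚ
  vanish = solve-∀ ℚ-ring
Bp-defect≡^ (suc n) p x = begin
  Bp-defect (suc n) p x
    ≡⟨ Bp-defect-suc n p x ⟩
  (x + ⟦ suc p ⟧) * Bp-defect n p x - ratio p * ⟦ suc (suc p) ⟧ * Bp-defect n (suc p) x
    ≡⟨ cong₂ (λ u v → (x + ⟦ suc p ⟧) * u - ratio p * ⟦ suc (suc p) ⟧ * v) (Bp-defect≡^ n p x) (Bp-defect≡^ n (suc p) x) ⟩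
  (x + ⟦ suc p ⟧) * (x ^q n) - ratio p * ⟦ suc (suc p) ⟧ * (x ^q n)
    ≡⟨ cong (λ c → (x + ⟦ suc p ⟧) * (x ^q n) - c * (x ^q n)) (ratio-*-suc p) ⟩
  (x + ⟦ suc p ⟧) * (x ^q n) - ⟦ suc p ⟧ * (x ^q n)
    ≡⟨ cancel x ⟦ suc p ⟧ (x ^q n) ⟩
  x * (x ^q n) ∎
  where
  cancel : ∀ x K X → (x + K) * X - K * X ≡ x * X
  cancel = solve-∀ ℚ-ring

Bppoly-at-0 : ∀ n p → Bppoly n p 0ℚ ≡ Bp n p
Bppoly-at-0 n p = trans (binomialSum≡appell n 0ℚ Bp[ p ]) (appell-at-0 n Bp[ p ])

Bppoly-difference : ∀ n p x →
  Bppoly n p (x + 1ℚ) ≡ x ^q n + ratio p * (Bppoly n (suc p) (x + 1ℚ) - Bppoly n (suc p) x)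
Bppoly-difference n p x =
  trans (split (Bppoly n p (x + 1ℚ)) (ratio p) (Bppoly n (suc p) (x + 1ℚ)) (Bppoly n (suc p) x))
        (cong (_+ ratio p * (Bppoly n (suc p) (x + 1ℚ) - Bppoly n (suc p) x)) (Bp-defect≡^ n p x))
  where
  split : ∀ U c W V → U ≡ U - c * (W - V) + c * (W - V)
  split = solve-∀ ℚ-ring

*-Bpoly-difference : ∀ n x → x * Bpoly n (x + 1ℚ) ≡ x * Bpoly n x + ⟦ n ⟧ * (x ^q n)
*-Bpoly-difference zero    x = pad x (Bpoly 0 x)
  where
  pad : ∀ x b → x * b ≡ x * b + 0ℚ * 1ℚ
  pad = solve-∀ ℚ-ring
*-Bpoly-difference (suc n) x =
  trans (cong (x *_) (Bpoly-difference n x)) (distrib x (Bpoly (suc n) x) ⟦ suc n ⟧ (x ^q n))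
  where
  distrib : ∀ x b K X → x * (b + K * X) ≡ x * b + K * (x * X)
  distrib = solve-∀ ℚ-ring

sumTo-powers : ∀ n m → sumTo m (λ k → ⟦ k ⟧ ^q n) ≡ (+ 1 / suc n) * (Bpoly (suc n) ⟦ suc m ⟧ - B (suc n))
sumTo-powers n m = begin
  sumTo m (λ k → ⟦ k ⟧ ^q n)                 ≡⟨ sumTo-cong m (λ k _ → power≡difference k) ⟩
  sumTo m (λ k → I * (g (suc k) - g k))      ≡⟨ sumTo-* m I _ ⟩
  I * sumTo m (λ k → g (suc k) - g k)        ≡⟨ cong (I *_) (sumTo-telescope m g) ⟩
  I * (g (suc m) - g 0)                      ≡⟨ cong (λ b → I * (g (suc m) - b)) (Bpoly-at-0 (suc n)) ⟩
  I * (g (suc m) - B (suc n))                ∎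
  where
  I = + 1 / suc n
  g : ℕ → ℚ
  g k = Bpoly (suc n) ⟦ k ⟧

  power≡difference : ∀ k → ⟦ k ⟧ ^q n ≡ I * (g (suc k) - g k)
  power≡difference k = sym (begin
    I * (g (suc k) - g k)                             ≡⟨ cong (λ y → I * (Bpoly (suc n) y - g k)) (⟦suc⟧ k) ⟩
    I * (Bpoly (suc n) (⟦ k ⟧ + 1ℚ) - g k)            ≡⟨ cong (λ b → I * (b - g k)) (Bpoly-difference n ⟦ k ⟧) ⟩
    I * (g k + ⟦ suc n ⟧ * (⟦ k ⟧ ^q n) - g k)        ≡⟨ cancel I (g k) ⟦ suc n ⟧ (⟦ k ⟧ ^q n) ⟩
    I * ⟦ suc n ⟧ * (⟦ k ⟧ ^q n)                      ≡⟨ cong (_* (⟦ k ⟧ ^q n)) (/-inverseˡ n) ⟩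
    1ℚ * (⟦ k ⟧ ^q n)                                 ≡⟨ *-identityˡ (⟦ k ⟧ ^q n) ⟩
    ⟦ k ⟧ ^q n                                        ∎)
    where
    cancel : ∀ I b K X → I * (b + K * X - b) ≡ I * K * X
    cancel = solve-∀ ℚ-ring

sumTo-Bppoly : ∀ n m p →
  sumTo m (λ k → Bppoly n p ⟦ suc k ⟧)
    ≡ (+ 1 / suc n) * (Bpoly (suc n) ⟦ suc m ⟧ - B (suc n))
      + (+ (suc p) / suc (suc p)) * (Bppoly n (suc p) ⟦ suc m ⟧ - Bp n (suc p))
sumTo-Bppoly n m p = begin
  sumTo m (λ k → Bppoly n p ⟦ suc k ⟧)
    ≡⟨ sumTo-cong m (λ k _ → trans (cong (Bppoly n p) (⟦suc⟧ k)) (shifted k)) ⟩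
  sumTo m (λ k → ⟦ k ⟧ ^q n + ratio p * (h (suc k) - h k))
    ≡⟨ sumTo-+ m _ _ ⟩
  sumTo m (λ k → ⟦ k ⟧ ^q n) + sumTo m (λ k → ratio p * (h (suc k) - h k))
    ≡⟨ cong₂ _+_ (sumTo-powers n m) (trans (sumTo-* m (ratio p) _) (cong (ratio p *_) (sumTo-telescope m h))) ⟩
  (+ 1 / suc n) * (Bpoly (suc n) ⟦ suc m ⟧ - B (suc n)) + ratio p * (h (suc m) - h 0)
    ≡⟨ cong (λ b → (+ 1 / suc n) * (Bpoly (suc n) ⟦ suc m ⟧ - B (suc n)) + ratio p * (h (suc m) - b))
            (Bppoly-at-0 n (suc p)) ⟩
  (+ 1 / suc n) * (Bpoly (suc n) ⟦ suc m ⟧ - B (suc n)) + ratio p * (h (suc m) - Bp n (suc p)) ∎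
  where
  h : ℕ → ℚ
  h k = Bppoly n (suc p) ⟦ k ⟧

  shifted : ∀ k → Bppoly n p (⟦ k ⟧ + 1ℚ) ≡ ⟦ k ⟧ ^q n + ratio p * (h (suc k) - h k)
  shifted k = trans (Bppoly-difference n p ⟦ k ⟧)
                    (cong (λ y → ⟦ k ⟧ ^q n + ratio p * (Bppoly n (suc p) y - h k)) (sym (⟦suc⟧ k)))

sumTo-Bpoly : ∀ n m →
  sumTo m (λ k → Bpoly n ⟦ suc k ⟧ + ⟦ n ⟧ * (⟦ k ⟧ ^q n)) ≡ ⟦ suc m ⟧ * Bpoly n ⟦ suc m ⟧
sumTo-Bpoly n m = begin
  sumTo m (λ k → Bpoly n ⟦ suc k ⟧ + ⟦ n ⟧ * (⟦ k ⟧ ^q n))   ≡⟨ sumTo-cong m (λ k _ → sym (step k)) ⟩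
  sumTo m (λ k → f (suc k) - f k)                           ≡⟨ sumTo-telescope m f ⟩
  f (suc m) - 0ℚ * Bpoly n 0ℚ                               ≡⟨ drop-zero (f (suc m)) (Bpoly n 0ℚ) ⟩
  f (suc m)                                                 ∎
  where
  f : ℕ → ℚ
  f k = ⟦ k ⟧ * Bpoly n ⟦ k ⟧

  step : ∀ k → f (suc k) - f k ≡ Bpoly n ⟦ suc k ⟧ + ⟦ n ⟧ * (⟦ k ⟧ ^q n)
  step k = begin
    ⟦ suc k ⟧ * Q - ⟦ k ⟧ * Bpoly n ⟦ k ⟧                  ≡⟨ cong (λ c → c * Q - ⟦ k ⟧ * Bpoly n ⟦ k ⟧) (⟦suc⟧ k) ⟩
    (⟦ k ⟧ + 1ℚ) * Q - ⟦ k ⟧ * Bpoly n ⟦ k ⟧               ≡⟨ expand ⟦ k ⟧ Q (Bpoly n ⟦ k ⟧) ⟩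
    Q + (⟦ k ⟧ * Q - ⟦ k ⟧ * Bpoly n ⟦ k ⟧)                ≡⟨ cong (λ y → Q + (⟦ k ⟧ * Bpoly n y - ⟦ k ⟧ * Bpoly n ⟦ k ⟧)) (⟦suc⟧ k) ⟩
    Q + (⟦ k ⟧ * Bpoly n (⟦ k ⟧ + 1ℚ) - ⟦ k ⟧ * Bpoly n ⟦ k ⟧)
      ≡⟨ cong (λ t → Q + (t - ⟦ k ⟧ * Bpoly n ⟦ k ⟧)) (*-Bpoly-difference n ⟦ k ⟧) ⟩
    Q + (⟦ k ⟧ * Bpoly n ⟦ k ⟧ + ⟦ n ⟧ * (⟦ k ⟧ ^q n) - ⟦ k ⟧ * Bpoly n ⟦ k ⟧)
      ≡⟨ cong (λ t → Q + t) (cancel (⟦ k ⟧ * Bpoly n ⟦ k ⟧) (⟦ n ⟧ * (⟦ k ⟧ ^q n))) ⟩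
    Q + ⟦ n ⟧ * (⟦ k ⟧ ^q n)                               ∎
    where
    Q = Bpoly n ⟦ suc k ⟧

    expand : ∀ x q b → (x + 1ℚ) * q - x * b ≡ q + (x * q - x * b)
    expand = solve-∀ ℚ-ring
    cancel : ∀ a b → a + b - a ≡ b
    cancel = solve-∀ ℚ-ring

  drop-zero : ∀ a b → a - 0ℚ * b ≡ a
  drop-zero = solve-∀ ℚ-ring

theorem3 : ((n m p : ℕ) →
    sumTo m (λ k → Bppoly n p ⟦ suc k ⟧)
    ≡ (+ 1 / suc n) * (Bpoly (suc n) ⟦ suc m ⟧ - B (suc n))
    + (+ (suc p) / suc (suc p)) * (Bppoly n (suc p) ⟦ suc m ⟧ - Bp n (suc p)))
    × ((n m : ℕ) →
    sumTo m (λ k → Bpoly n ⟦ suc k ⟧ + ⟦ n ⟧ * (⟦ k ⟧ ^q n))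
    ≡ ⟦ suc m ⟧ * Bpoly n ⟦ suc m ⟧)
theorem3 = sumTo-Bppoly , sumTo-Bpoly
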